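{- Let $\Gamma$ be a distance-regular graph with diameter $D\ge3$ and valency $k$. Suppose there exist real numbers $\theta,\theta',\theta''$ such that none of them equals $k$, $\theta'\ne\theta''$, the pair $\theta,\theta'$ is tight, and the pair $\theta,\theta''$ is tight. Then $a_i=0$ for $0\le i\le D-2$, and $\theta=-k$.
   Context: $\Gamma$ is a finite, undirected, connected graph without loops or multiple edges, with path-length distance $\partial$ and diameter $D$. It is distance-regular: for all $0\le h,i,j\le D$ and all vertices $x,y$ with $\partial(x,y)=h$, the number $p^h_{ij}$ of vertices $z$ with $\partial(x,z)=i$, $\partial(y,z)=j$ depends only on $h,i,j$. Write $a_i=p^i_{1i}$, $b_i=p^i_{1,i+1}$ $(0\le i\le D-1)$, $c_i=p^i_{1,i-1}$ $(1\le i\le D)$, $c_0=0$, $b_D=0$, $k=b_0$. For $\theta\in\mathbb{R}$, the pseudo cosine sequence for $\theta$ is the sequence of reals $\sigma_0,\dots,\sigma_D$ with $\sigma_0=1$ and $c_i\sigma_{i-1}+a_i\sigma_i+b_i\sigma_{i+1}=\theta\sigma_i$ for $0\le i\le D-1$ (with $c_0\sigma_{ -1}=0$). Two pseudo cosine sequences $\sigma_i,\rho_i$ form a tight pair if $\sigma_0\rho_0,\dots,\sigma_D\rho_D$ is a pseudo cosine sequence; reals $\theta,\theta'$ form a tight pair if their pseudo cosine sequences do. -}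

module Defs where

open import Data.Nat using (ℕ; zero; suc; _≤_; _<_; _∸_)
open import Data.Bool using (Bool; true; false; _∧_; _∨_; if_then_else_)
open import Data.Fin using (Fin)
open import Data.List using (List; length; filter)
open import Data.Bool.ListAction using (any)
open import Data.List using () renaming (allFin to allFinL)
open import Data.Product using (Σ; ∃; _×_; _,_)
open import Relation.Binary.PropositionalEquality using (_≡_; _≢_)
open import Relation.Binary.Structures using (IsTotalOrder)
open import Algebra.Structures using (IsCommutativeRing)
open import Relation.Nullary using (¬_)
import Data.Nat as N
open import Data.Bool.Properties using (T?)
open import Data.Fin using () renaming (_≟_ to _≟F_)
open import Relation.Nullary.Decidable using (⌊_⌋)

-- The real numbers, given axiomatically as a Dedekind-complete
-- ordered field (any model is isomorphic to ℝ).  Statements are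
-- quantified over an arbitrary such model.

record RealField : Set₁ where
  infixl 6 _+_
  infixl 7 _*_
  infix  4 _≤ᵣ_
  field
    Carrier : Set
    _+_ _*_ : Carrier → Carrier → Carrier
    -_      : Carrier → Carrier
    0# 1#   : Carrier
    _≤ᵣ_    : Carrier → Carrier → Set
    isCommutativeRing : IsCommutativeRing _≡_ _+_ _*_ -_ 0# 1#
    0≢1     : 0# ≢ 1#
    inverse : ∀ x → x ≢ 0# → Σ Carrier (λ y → x * y ≡ 1#)
    isTotalOrder : IsTotalOrder _≡_ _≤ᵣ_
    +-mono  : ∀ x y z → x ≤ᵣ y → x + z ≤ᵣ y + z
    *-pos   : ∀ x y → 0# ≤ᵣ x → 0# ≤ᵣ y → 0# ≤ᵣ x * y
    complete : (P : Carrier → Set) → Σ Carrier P →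
               Σ Carrier (λ u → ∀ x → P x → x ≤ᵣ u) →
               Σ Carrier (λ s → (∀ x → P x → x ≤ᵣ s) ×
                                (∀ u → (∀ x → P x → x ≤ᵣ u) → s ≤ᵣ u))

  fromℕ : ℕ → Carrier
  fromℕ zero    = 0#
  fromℕ (suc m) = 1# + fromℕ m

record Graph : Set where
  field
    n     : ℕ
    adj   : Fin n → Fin n → Bool
    sym   : ∀ x y → adj x y ≡ adj y x
    irrefl : ∀ x → adj x x ≡ false

  vertices : List (Fin n)
  vertices = allFinL n

  eqᵇ : Fin n → Fin n → Bool
  eqᵇ x y = ⌊ x ≟F y ⌋

  reach : ℕ → Fin n → Fin n → Bool
  reach zero    x y = eqᵇ x y
  reach (suc m) x y = reach m x y ∨ any (λ z → reach m x z ∧ adj z y) vertices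

  search : ℕ → ℕ → Fin n → Fin n → ℕ
  search m zero      x y = m
  search m (suc fuel) x y = if reach m x y then m else search (suc m) fuel x y

  -- path-length distance ∂ (correct for connected graphs, where ∂ < n)
  dist : Fin n → Fin n → ℕ
  dist x y = search 0 n x y

  Connected : Set
  Connected = ∀ x y → reach n x y ≡ true

  count : (Fin n → Bool) → ℕ
  count P = length (filter (λ z → T? (P z)) vertices)

  HasDiameter : ℕ → Set
  HasDiameter D = (∀ x y → dist x y ≤ D) × Σ (Fin n) (λ x → Σ (Fin n) (λ y → dist x y ≡ D))

  IsDistanceRegular : ℕ → (ℕ → ℕ → ℕ → ℕ) → Set
  IsDistanceRegular D p =
    ∀ h i j → h ≤ D → i ≤ D → j ≤ D → ∀ x y → dist x y ≡ h →
      count (λ z → (dist x z N.≡ᵇ i) ∧ (dist y z N.≡ᵇ j)) ≡ p h i j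

module DRG (R : RealField) (D : ℕ) (p : ℕ → ℕ → ℕ → ℕ) where
  open RealField R

  a b c : ℕ → ℕ
  a i = p i 1 i
  b i = p i 1 (suc i)
  c zero    = 0
  c (suc i) = p (suc i) 1 i

  k : ℕ
  k = b 0

  lowerTerm : (ℕ → Carrier) → ℕ → Carrier
  lowerTerm σ zero    = 0#
  lowerTerm σ (suc i) = fromℕ (c (suc i)) * σ i

  IsPseudoCosine : Carrier → (ℕ → Carrier) → Set
  IsPseudoCosine θ σ =
    (σ 0 ≡ 1#) ×
    (∀ i → i < D →
       lowerTerm σ i + fromℕ (a i) * σ i + fromℕ (b i) * σ (suc i) ≡ θ * σ i)

  TightSeq : (ℕ → Carrier) → (ℕ → Carrier) → Set
  TightSeq σ ρ = Σ Carrier (λ η → IsPseudoCosine η (λ i → σ i * ρ i))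

  TightPair : Carrier → Carrier → Set
  TightPair θ θ' = Σ (ℕ → Carrier) (λ σ → Σ (ℕ → Carrier) (λ ρ →
    IsPseudoCosine θ σ × IsPseudoCosine θ' ρ × TightSeq σ ρ))

-- Let σ be the pseudo cosine sequence of θ; as a₀ = 0, θ = kσ₁. For a tight partner θ' = kρ₁ ≠ k
-- of θ, the recurrences at 1 of σ, ρ and σρ leave (ρ₁ − 1)(α(ρ₁ + 1) + β) = 0 with α, β depending
-- on σ only, so two distinct partners force α = β = 0; this gives σ₁² = 1, hence σ₁ = −1 as θ ≠ k,
-- i.e. θ = −k. Then σρ belongs to −θ' for every partner, and induction on i gives σᵢ₊₁ = −σᵢ ≠ 0
-- and aᵢ = 0: if aᵢ ≠ 0, the recurrences at i force ρᵢ = ρᵢ₊₁ for each partner, and those at i + 1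
-- then make θ' a root of an affine equation determined by σ that cannot have both θ' and θ'' as roots.

module Submission where

open import Defs
open import Data.Nat using (ℕ; _≤_; _∸_)
open import Relation.Binary.PropositionalEquality using (_≡_; _≢_)
open import Data.Product using (_×_)

open import Data.Nat as ℕ using (zero; suc; _<_; _≡ᵇ_; s≤s; z≤n)
import Data.Nat.Properties as ℕ
open import Data.Nat.Solver using (module +-*-Solver)
open import Data.Integer as ℤ using (ℤ; -[1+_]; +[1+_]; _⊖_)
import Data.Integer.Properties as ℤ
open import Data.Bool using (Bool; true; false; T; _∧_; if_then_else_)
open import Data.Bool.Properties using (T?; T-≡; T-∨; T-∧)
open import Data.Fin using (Fin)
open import Data.List using (List; []; _∷_; length; filter)
open import Data.List.Properties using (filter-none; filter-some)
open import Data.List.Relation.Unary.All using (universal)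
open import Data.List.Relation.Unary.Any using (satisfied)
open import Data.List.Relation.Unary.Any.Properties using (any⁺; any⁻)
open import Data.List.Membership.Propositional using (lose)
open import Data.List.Membership.Propositional.Properties using (∈-allFin)
open import Data.Maybe using (Maybe; just; nothing)
open import Data.Product using (Σ; _,_; proj₁; proj₂; uncurry)
open import Data.Sum using (_⊎_; inj₁; inj₂)
open import Data.Empty using (⊥; ⊥-elim)
open import Function using (_∘_; _$_; Equivalence)
open import Level using (0ℓ)
open import Relation.Nullary using (¬_; yes; no)
open import Relation.Nullary.Decidable using (toWitness; fromWitness)
open import Relation.Binary.PropositionalEquality
open import Relation.Binary.Structures using (IsTotalOrder)
open import Algebra.Bundles using (CommutativeRing)
import Algebra.Properties.Ring as RingProperties
open import Algebra.Solver.Ring.AlmostCommutativeRing using (_-Raw-AlmostCommutative⟶_; fromCommutativeRing)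

open Equivalence using (to; from)

module RealFieldFacts (R : RealField) where
  open RealField R
  open ≡-Reasoning

  commutativeRing : CommutativeRing 0ℓ 0ℓ
  commutativeRing = record { isCommutativeRing = isCommutativeRing }

  open CommutativeRing commutativeRing public
    using (+-assoc; +-comm; +-identityˡ; +-identityʳ; *-identityˡ; *-identityʳ;
           distribʳ; zeroˡ; zeroʳ; -‿inverseʳ; ring)
  open RingProperties ring public using (-‿involutive; -‿distribˡ-*; -‿anti-homo-+; -0#≈0#)

  fromℕ-+ : ∀ m n → fromℕ (m ℕ.+ n) ≡ fromℕ m + fromℕ n
  fromℕ-+ zero    n = sym (+-identityˡ _)
  fromℕ-+ (suc m) n = trans (cong (1# +_) (fromℕ-+ m n)) (sym (+-assoc _ _ _))

  fromℕ-* : ∀ m n → fromℕ (m ℕ.* n) ≡ fromℕ m * fromℕ n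
  fromℕ-* zero    n = sym (zeroˡ _)
  fromℕ-* (suc m) n = begin
    fromℕ (n ℕ.+ m ℕ.* n)         ≡⟨ fromℕ-+ n (m ℕ.* n) ⟩
    fromℕ n + fromℕ (m ℕ.* n)     ≡⟨ cong₂ _+_ (sym (*-identityˡ _)) (fromℕ-* m n) ⟩
    1# * fromℕ n + fromℕ m * fromℕ n ≡⟨ sym (distribʳ _ _ _) ⟩
    (1# + fromℕ m) * fromℕ n      ∎

  -‿+-distrib : ∀ x y → - (x + y) ≡ - x + - y
  -‿+-distrib x y = trans (-‿anti-homo-+ x y) (+-comm _ _)

  ι : ℤ → Carrier
  ι (ℤ.+ n)    = fromℕ n
  ι -[1+ n ] = - fromℕ (suc n)

  ι-⊖ : ∀ m n → ι (m ⊖ n) ≡ fromℕ m + - fromℕ n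
  ι-⊖ m       zero    = begin
    ι (m ⊖ 0)       ≡⟨ cong ι (ℤ.⊖-≥ {m} {0} ℕ.z≤n) ⟩
    fromℕ m         ≡⟨ sym (+-identityʳ _) ⟩
    fromℕ m + 0#    ≡⟨ cong (fromℕ m +_) (sym -0#≈0#) ⟩
    fromℕ m + - 0#  ∎
  ι-⊖ zero    (suc n) = trans (cong ι (ℤ.⊖-< {0} {suc n} (ℕ.s≤s ℕ.z≤n))) (sym (+-identityˡ _))
  ι-⊖ (suc m) (suc n) = begin
    ι (suc m ⊖ suc n)                 ≡⟨ cong ι (ℤ.[1+m]⊖[1+n]≡m⊖n m n) ⟩
    ι (m ⊖ n)                         ≡⟨ ι-⊖ m n ⟩
    fromℕ m + - fromℕ n               ≡⟨ sym (+-identityˡ _) ⟩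
    0# + (fromℕ m + - fromℕ n)        ≡⟨ cong (_+ (fromℕ m + - fromℕ n)) (sym (-‿inverseʳ 1#)) ⟩
    (1# + - 1#) + (fromℕ m + - fromℕ n) ≡⟨ +-assoc _ _ _ ⟩
    1# + (- 1# + (fromℕ m + - fromℕ n)) ≡⟨ cong (1# +_) (sym (+-assoc _ _ _)) ⟩
    1# + ((- 1# + fromℕ m) + - fromℕ n) ≡⟨ cong (λ t → 1# + (t + - fromℕ n)) (+-comm _ _) ⟩
    1# + ((fromℕ m + - 1#) + - fromℕ n) ≡⟨ cong (1# +_) (+-assoc _ _ _) ⟩
    1# + (fromℕ m + (- 1# + - fromℕ n)) ≡⟨ sym (+-assoc _ _ _) ⟩
    (1# + fromℕ m) + (- 1# + - fromℕ n) ≡⟨ cong ((1# + fromℕ m) +_) (sym (-‿+-distrib _ _)) ⟩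
    (1# + fromℕ m) + - (1# + fromℕ n) ∎

  ι-+ : ∀ x y → ι (x ℤ.+ y) ≡ ι x + ι y
  ι-+ (ℤ.+ m)    (ℤ.+ n)    = fromℕ-+ m n
  ι-+ (ℤ.+ m)    -[1+ n ] = ι-⊖ m (suc n)
  ι-+ -[1+ m ] (ℤ.+ n)    = trans (ι-⊖ n (suc m)) (+-comm _ _)
  ι-+ -[1+ m ] -[1+ n ] = begin
    - (1# + fromℕ (suc m ℕ.+ n))         ≡⟨ cong (λ t → - (1# + t)) (fromℕ-+ (suc m) n) ⟩
    - (1# + ((1# + fromℕ m) + fromℕ n))  ≡⟨ cong -_ (trans (sym (+-assoc _ _ _)) (cong (_+ fromℕ n) (+-comm _ _))) ⟩
    - (((1# + fromℕ m) + 1#) + fromℕ n)  ≡⟨ cong -_ (+-assoc _ _ _) ⟩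
    - ((1# + fromℕ m) + (1# + fromℕ n))  ≡⟨ -‿+-distrib _ _ ⟩
    - (1# + fromℕ m) + - (1# + fromℕ n)  ∎

  ι-neg : ∀ z → ι (ℤ.- z) ≡ - ι z
  ι-neg (ℤ.+ zero)   = sym -0#≈0#
  ι-neg +[1+ n ]   = refl
  ι-neg -[1+ n ]   = sym (-‿involutive _)

  ι-*-+ : ∀ m y → ι (ℤ.+ m ℤ.* y) ≡ fromℕ m * ι y
  ι-*-+ zero    y = sym (zeroˡ _)
  ι-*-+ (suc m) y = begin
    ι (ℤ.+ suc m ℤ.* y)           ≡⟨ cong ι (ℤ.suc-* (ℤ.+ m) y) ⟩
    ι (y ℤ.+ ℤ.+ m ℤ.* y)       ≡⟨ ι-+ y (ℤ.+ m ℤ.* y) ⟩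
    ι y + ι (ℤ.+ m ℤ.* y)         ≡⟨ cong₂ _+_ (sym (*-identityˡ _)) (ι-*-+ m y) ⟩
    1# * ι y + fromℕ m * ι y    ≡⟨ sym (distribʳ _ _ _) ⟩
    (1# + fromℕ m) * ι y        ∎

  ι-* : ∀ x y → ι (x ℤ.* y) ≡ ι x * ι y
  ι-* (ℤ.+ m)    y = ι-*-+ m y
  ι-* -[1+ m ] y = begin
    ι (-[1+ m ] ℤ.* y)          ≡⟨ cong ι (sym (ℤ.neg-distribˡ-* +[1+ m ] y)) ⟩
    ι (ℤ.- (+[1+ m ] ℤ.* y))    ≡⟨ ι-neg (+[1+ m ] ℤ.* y) ⟩
    - ι (+[1+ m ] ℤ.* y)        ≡⟨ cong -_ (ι-*-+ (suc m) y) ⟩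
    - (fromℕ (suc m) * ι y)     ≡⟨ -‿distribˡ-* _ _ ⟩
    - fromℕ (suc m) * ι y       ∎

  -- Unlike ι, fromℤ sends 1 to 1# on the nose: the solver interprets constants by fromℤ,
  -- and the goals below contain 1#, not 1# + 0#.
  fromℕ₁ : ℕ → Carrier
  fromℕ₁ zero          = 0#
  fromℕ₁ (suc zero)    = 1#
  fromℕ₁ (suc (suc n)) = 1# + fromℕ₁ (suc n)

  fromℕ₁≗fromℕ : ∀ n → fromℕ₁ n ≡ fromℕ n
  fromℕ₁≗fromℕ zero          = refl
  fromℕ₁≗fromℕ (suc zero)    = sym (+-identityʳ 1#)
  fromℕ₁≗fromℕ (suc (suc n)) = cong (1# +_) (fromℕ₁≗fromℕ (suc n))

  fromℤ : ℤ → Carrier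
  fromℤ (ℤ.+ n)  = fromℕ₁ n
  fromℤ -[1+ n ] = - fromℕ₁ (suc n)

  fromℤ≗ι : ∀ z → fromℤ z ≡ ι z
  fromℤ≗ι (ℤ.+ n)  = fromℕ₁≗fromℕ n
  fromℤ≗ι -[1+ n ] = cong -_ (fromℕ₁≗fromℕ (suc n))

  fromℤ-hom₂ : ∀ (_∘_ : Carrier → Carrier → Carrier) z x y →
               ι z ≡ ι x ∘ ι y → fromℤ z ≡ fromℤ x ∘ fromℤ y
  fromℤ-hom₂ _∘_ z x y ι-hom = trans (fromℤ≗ι z) (trans ι-hom (sym (cong₂ _∘_ (fromℤ≗ι x) (fromℤ≗ι y))))

  fromℤ-homomorphism : ℤ.+-*-rawRing -Raw-AlmostCommutative⟶ fromCommutativeRing commutativeRing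
  fromℤ-homomorphism = record
    { ⟦_⟧    = fromℤ
    ; +-homo = λ x y → fromℤ-hom₂ _+_ (x ℤ.+ y) x y (ι-+ x y)
    ; *-homo = λ x y → fromℤ-hom₂ _*_ (x ℤ.* y) x y (ι-* x y)
    ; -‿homo = λ z → trans (fromℤ≗ι (ℤ.- z)) (trans (ι-neg z) (cong -_ (sym (fromℤ≗ι z))))
    ; 0-homo = refl
    ; 1-homo = refl
    }

  fromℤ-≟ : ∀ x y → Maybe (fromℤ x ≡ fromℤ y)
  fromℤ-≟ x y with x ℤ.≟ y
  ... | yes x≡y = just (cong fromℤ x≡y)
  ... | no  _   = nothing

  open import Algebra.Solver.Ring ℤ.+-*-rawRing (fromCommutativeRing commutativeRing) fromℤ-homomorphism fromℤ-≟ public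

  :0 :1 :2 : ∀ {n} → Polynomial n
  :0 = con (ℤ.+ 0)
  :1 = con (ℤ.+ 1)
  :2 = con (ℤ.+ 2)

  x≡y⇒x-y≡0 : ∀ {x y} → x ≡ y → x + - y ≡ 0#
  x≡y⇒x-y≡0 {x} refl = -‿inverseʳ x

  x-y≡0⇒x≡y : ∀ {x y} → x + - y ≡ 0# → x ≡ y
  x-y≡0⇒x≡y {x} {y} x-y≡0 = begin
    x                ≡⟨ solve 2 (λ x y → x := (x :- y) :+ y) refl x y ⟩
    (x + - y) + y    ≡⟨ cong (_+ y) x-y≡0 ⟩
    0# + y           ≡⟨ +-identityˡ y ⟩
    y                ∎

  -- A polynomial consequence of hᵢ : eᵢ ≡ 0# is proved by a `solve`-checked identity
  -- goal = c₁ * e₁ + … + cₙ * eₙ, whose right-hand side vanishes by multiple h₁ ⊞ … ⊞ multiple hₙ.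
  multiple : ∀ {c e} → e ≡ 0# → c * e ≡ 0#
  multiple {c} refl = zeroʳ c

  infixl 6 _⊞_
  _⊞_ : ∀ {x y} → x ≡ 0# → y ≡ 0# → x + y ≡ 0#
  refl ⊞ refl = +-identityʳ 0#

  module ≤ = IsTotalOrder isTotalOrder

  0≤1 : 0# ≤ᵣ 1#
  0≤1 with ≤.total 0# 1#
  ... | inj₁ 0≤1 = 0≤1
  ... | inj₂ 1≤0 = ⊥-elim (0≢1 (≤.antisym (subst (0# ≤ᵣ_) -1*-1≡1 (*-pos (- 1#) (- 1#) 0≤-1 0≤-1)) 1≤0))
    where
    0≤-1 : 0# ≤ᵣ - 1#
    0≤-1 = subst₂ _≤ᵣ_ (-‿inverseʳ 1#) (+-identityˡ _) (+-mono 1# 0# (- 1#) 1≤0)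
    -1*-1≡1 : - 1# * - 1# ≡ 1#
    -1*-1≡1 = solve 0 (:- :1 :* :- :1 := :1) refl

  1≤fromℕ-suc : ∀ n → 1# ≤ᵣ fromℕ (suc n)
  0≤fromℕ : ∀ n → 0# ≤ᵣ fromℕ n
  0≤fromℕ zero    = ≤.refl
  0≤fromℕ (suc n) = ≤.trans 0≤1 (1≤fromℕ-suc n)
  1≤fromℕ-suc n = subst₂ _≤ᵣ_ (+-identityˡ _) (+-comm _ _) (+-mono 0# (fromℕ n) 1# (0≤fromℕ n))

  fromℕ-≢0 : ∀ {n} → n ≢ 0 → fromℕ n ≢ 0#
  fromℕ-≢0 {zero}  n≢0 = ⊥-elim (n≢0 refl)
  fromℕ-≢0 {suc n} _ fromℕ≡0 = 0≢1 (≤.antisym 0≤1 (subst (1# ≤ᵣ_) fromℕ≡0 (1≤fromℕ-suc n)))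

  x*y≡0⇒y≡0 : ∀ {x y} → x ≢ 0# → x * y ≡ 0# → y ≡ 0#
  x*y≡0⇒y≡0 {x} {y} x≢0 xy≡0 with inverse x x≢0
  ... | x⁻¹ , xx⁻¹≡1 = begin
    y                 ≡⟨ solve 3 (λ x x⁻¹ y → y := y :* (:1 :- x :* x⁻¹) :+ x⁻¹ :* (x :* y)) refl x x⁻¹ y ⟩
    y * (1# + - (x * x⁻¹)) + x⁻¹ * (x * y) ≡⟨ multiple (x≡y⇒x-y≡0 (sym xx⁻¹≡1)) ⊞ multiple xy≡0 ⟩
    0#                ∎

  *-≢0 : ∀ {x y} → x ≢ 0# → y ≢ 0# → x * y ≢ 0#
  *-≢0 x≢0 y≢0 xy≡0 = y≢0 (x*y≡0⇒y≡0 x≢0 xy≡0)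

  *-cancelˡ : ∀ {x y z} → x ≢ 0# → x * y ≡ x * z → y ≡ z
  *-cancelˡ {x} {y} {z} x≢0 xy≡xz = x-y≡0⇒x≡y (x*y≡0⇒y≡0 x≢0 (begin
    x * (y + - z)           ≡⟨ solve 3 (λ x y z → x :* (y :- z) := x :* y :- x :* z) refl x y z ⟩
    x * y + - (x * z)       ≡⟨ x≡y⇒x-y≡0 xy≡xz ⟩
    0#                      ∎))

module Distances (Γ : Graph) (connected : Graph.Connected Γ) where
  open Graph Γ renaming (n to order; sym to adj-sym)

  Vertex : Set
  Vertex = Fin order

  reach-refl : ∀ x → T (reach 0 x x)
  reach-refl x = fromWitness refl

  reach-zero⁻ : ∀ {x y} → T (reach 0 x y) → x ≡ y
  reach-zero⁻ = toWitness

  reach-suc⁺ : ∀ m {x y} → T (reach m x y) → T (reach (suc m) x y)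
  reach-suc⁺ m r = from T-∨ (inj₁ r)

  reach-step : ∀ m {x z y} → T (reach m x z) → T (adj z y) → T (reach (suc m) x y)
  reach-step m {z = z} r a = from T-∨ (inj₂ (any⁺ _ (lose (∈-allFin z) (from T-∧ (r , a)))))

  reach-suc⁻ : ∀ m {x y} → T (reach (suc m) x y) →
               T (reach m x y) ⊎ Σ Vertex (λ z → T (reach m x z) × T (adj z y))
  reach-suc⁻ m r with to T-∨ r
  ... | inj₁ r′ = inj₁ r′
  ... | inj₂ r′ with satisfied (any⁻ _ vertices r′)
  ...   | z , rz∧a = inj₂ (z , to T-∧ rz∧a)

  adjacent-sym : ∀ {x y} → T (adj x y) → T (adj y x)
  adjacent-sym {x} {y} = subst T (adj-sym x y)

  reach-prepend : ∀ m {w z x} → T (adj w z) → T (reach m z x) → T (reach (suc m) w x)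
  reach-prepend zero    {w} a r with reach-zero⁻ r
  ... | refl = reach-step 0 (reach-refl w) a
  reach-prepend (suc m) a r with reach-suc⁻ m r
  ... | inj₁ r′           = reach-suc⁺ (suc m) (reach-prepend m a r′)
  ... | inj₂ (_ , r′ , a′) = reach-step (suc m) (reach-prepend m a r′) a′

  reach-sym : ∀ m {x y} → T (reach m x y) → T (reach m y x)
  reach-sym zero    r with reach-zero⁻ r
  ... | refl = r
  reach-sym (suc m) r with reach-suc⁻ m r
  ... | inj₁ r′          = reach-suc⁺ m (reach-sym m r′)
  ... | inj₂ (_ , r′ , a) = reach-prepend m (adjacent-sym a) (reach-sym m r′)

  search-reach : ∀ m fuel {x y} → T (reach (m ℕ.+ fuel) x y) → T (reach (search m fuel x y) x y)
  search-reach m zero       {x} {y} r = subst (λ t → T (reach t x y)) (ℕ.+-identityʳ m) r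
  search-reach m (suc fuel) {x} {y} r with reach m x y in eq
  ... | true  = from T-≡ eq
  ... | false = search-reach (suc m) fuel (subst (λ t → T (reach t x y)) (ℕ.+-suc m fuel) r)

  search-minimal : ∀ m fuel {x y m′} → T (reach m′ x y) → m ≤ m′ → search m fuel x y ≤ m′
  search-minimal m zero       r m≤m′ = m≤m′
  search-minimal m (suc fuel) {x} {y} {m′} r m≤m′ with reach m x y in eq
  ... | true  = m≤m′
  ... | false = search-minimal (suc m) fuel r (ℕ.≤∧≢⇒< m≤m′ m≢m′)
    where
    m≢m′ : m ≢ m′
    m≢m′ refl with trans (sym eq) (to T-≡ r)
    ... | ()

  dist-reach : ∀ x y → T (reach (dist x y) x y)
  dist-reach x y = search-reach 0 order (from T-≡ (connected x y))

  dist-minimal : ∀ {m x y} → T (reach m x y) → dist x y ≤ m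
  dist-minimal r = search-minimal 0 order r z≤n

  dist-sym : ∀ x y → dist x y ≡ dist y x
  dist-sym x y = ℕ.≤-antisym (dist-minimal (reach-sym (dist y x) {y} {x} (dist-reach y x)))
                             (dist-minimal (reach-sym (dist x y) {x} {y} (dist-reach x y)))

  dist-refl : ∀ x → dist x x ≡ 0
  dist-refl x = ℕ.n≤0⇒n≡0 (dist-minimal (reach-refl x))

  dist≡0⇒≡ : ∀ {x y} → dist x y ≡ 0 → x ≡ y
  dist≡0⇒≡ {x} {y} d≡0 = reach-zero⁻ (subst (λ t → T (reach t x y)) d≡0 (dist-reach x y))

  dist-adj-≤ : ∀ {x z y} → T (adj z y) → dist x y ≤ suc (dist x z)
  dist-adj-≤ {x} {z} {y} a = dist-minimal (reach-step (dist x z) {x} {z} {y} (dist-reach x z) a)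

  adj⇒dist≡1 : ∀ {x y} → T (adj x y) → dist x y ≡ 1
  adj⇒dist≡1 {x} {y} a with dist x y in eq | dist-minimal {1} {x} {y} (reach-step 0 (reach-refl x) a)
  ... | suc zero     | _         = refl
  ... | suc (suc _)  | s≤s ()
  ... | zero         | _ with dist≡0⇒≡ eq
  ...   | refl = ⊥-elim (subst T (irrefl x) a)

  dist≡1⇒adj : ∀ {x y} → dist x y ≡ 1 → T (adj x y)
  dist≡1⇒adj {x} {y} d≡1 with reach-suc⁻ 0 (subst (λ t → T (reach t x y)) d≡1 (dist-reach x y))
  ... | inj₁ r with reach-zero⁻ r
  ...   | refl with trans (sym d≡1) (dist-refl x)
  ...     | ()
  dist≡1⇒adj d≡1 | inj₂ (z , r , a) with reach-zero⁻ r
  ... | refl = a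

  predecessor : ∀ {u v m} → dist u v ≡ suc m → Σ Vertex (λ w → dist u w ≡ m × T (adj w v))
  predecessor {u} {v} {m} d≡m+1 with reach-suc⁻ m (subst (λ t → T (reach t u v)) d≡m+1 (dist-reach u v))
  ... | inj₁ r = ⊥-elim (ℕ.<-irrefl refl (subst (_≤ m) d≡m+1 (dist-minimal r)))
  ... | inj₂ (w , r , a) =
    w , ℕ.≤-antisym (dist-minimal r) (ℕ.≤-pred (subst (_≤ suc (dist u w)) d≡m+1 (dist-adj-≤ a))) , a

  vertex-at-distance : ∀ {u} d m {v} → dist u v ≡ d ℕ.+ m → Σ Vertex (λ w → dist u w ≡ m)
  vertex-at-distance zero    m {v} d≡m = v , d≡m
  vertex-at-distance (suc d) m d≡   = vertex-at-distance d m (proj₁ (proj₂ (predecessor d≡)))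

  countIn : (Vertex → Bool) → List Vertex → ℕ
  countIn P xs = length (filter (λ z → T? (P z)) xs)

  count-none : ∀ P → (∀ z → ¬ T (P z)) → count P ≡ 0
  count-none P ¬P = cong length (filter-none (T? ∘ P) (universal ¬P vertices))

  count-some : ∀ P {z} → T (P z) → count P ≢ 0
  count-some P {z} Pz count≡0 with filter-some (T? ∘ P) (lose (∈-allFin z) Pz)
  ... | 0<count rewrite count≡0 = ℕ.<-irrefl refl 0<count

  indicator : Bool → ℕ
  indicator b = if b then 1 else 0

  countIn-∷ : ∀ P x xs → countIn P (x ∷ xs) ≡ indicator (P x) ℕ.+ countIn P xs
  countIn-∷ P x xs with P x
  ... | true  = refl
  ... | false = refl

  countIn-sum₃ : ∀ P Q₁ Q₂ Q₃ →
                 (∀ z → indicator (P z) ≡ indicator (Q₁ z) ℕ.+ indicator (Q₂ z) ℕ.+ indicator (Q₃ z)) →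
                 ∀ xs → countIn P xs ≡ countIn Q₁ xs ℕ.+ countIn Q₂ xs ℕ.+ countIn Q₃ xs
  countIn-sum₃ P Q₁ Q₂ Q₃ P≡Q₁+Q₂+Q₃ []       = refl
  countIn-sum₃ P Q₁ Q₂ Q₃ P≡Q₁+Q₂+Q₃ (x ∷ xs) = begin
    countIn P (x ∷ xs)
      ≡⟨ countIn-∷ P x xs ⟩
    indicator (P x) ℕ.+ countIn P xs
      ≡⟨ cong₂ ℕ._+_ (P≡Q₁+Q₂+Q₃ x) (countIn-sum₃ P Q₁ Q₂ Q₃ P≡Q₁+Q₂+Q₃ xs) ⟩
    (q₁ ℕ.+ q₂ ℕ.+ q₃) ℕ.+ (n₁ ℕ.+ n₂ ℕ.+ n₃)
      ≡⟨ solve 6 (λ q₁ q₂ q₃ n₁ n₂ n₃ →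
                   (q₁ :+ q₂ :+ q₃) :+ (n₁ :+ n₂ :+ n₃) := (q₁ :+ n₁) :+ (q₂ :+ n₂) :+ (q₃ :+ n₃))
                 refl q₁ q₂ q₃ n₁ n₂ n₃ ⟩
    (q₁ ℕ.+ n₁) ℕ.+ (q₂ ℕ.+ n₂) ℕ.+ (q₃ ℕ.+ n₃)
      ≡⟨ sym (cong₂ ℕ._+_ (cong₂ ℕ._+_ (countIn-∷ Q₁ x xs) (countIn-∷ Q₂ x xs)) (countIn-∷ Q₃ x xs)) ⟩
    countIn Q₁ (x ∷ xs) ℕ.+ countIn Q₂ (x ∷ xs) ℕ.+ countIn Q₃ (x ∷ xs) ∎
    where
    open ≡-Reasoning
    open +-*-Solver
    q₁ = indicator (Q₁ x)
    q₂ = indicator (Q₂ x)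
    q₃ = indicator (Q₃ x)
    n₁ = countIn Q₁ xs
    n₂ = countIn Q₂ xs
    n₃ = countIn Q₃ xs

  indicator-window : ∀ j e → j ≤ e → e ≤ suc (suc j) →
                     indicator (e ≡ᵇ suc j) ℕ.+ indicator (e ≡ᵇ suc (suc j)) ℕ.+ indicator (e ≡ᵇ j) ≡ 1
  indicator-window zero    zero                _   _              = refl
  indicator-window zero    (suc zero)          _   _              = refl
  indicator-window zero    (suc (suc zero))    _   _              = refl
  indicator-window zero    (suc (suc (suc _))) _   (s≤s (s≤s ()))
  indicator-window (suc j) (suc e)             j≤e e≤j+2 = indicator-window j e (ℕ.≤-pred j≤e) (ℕ.≤-pred e≤j+2)

  module IntersectionNumbers (D : ℕ) (p : ℕ → ℕ → ℕ → ℕ) (diameter : HasDiameter D)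
                             (regular : IsDistanceRegular D p) (1≤D : 1 ≤ D) where

    u : Vertex
    u = proj₁ (proj₂ diameter)

    vertex-at : ∀ m → m ≤ D → Σ Vertex (λ w → dist u w ≡ m)
    vertex-at m m≤D = vertex-at-distance (D ∸ m) m
      (trans (proj₂ (proj₂ (proj₂ diameter))) (sym (ℕ.m∸n+n≡m m≤D)))

    a₀≡0 : p 0 1 0 ≡ 0
    a₀≡0 = trans (sym (regular 0 1 0 z≤n 1≤D z≤n u u (dist-refl u))) (count-none _ at-1-and-0)
      where
      at-1-and-0 : ∀ z → ¬ T ((dist u z ≡ᵇ 1) ∧ (dist u z ≡ᵇ 0))
      at-1-and-0 z with dist u z
      ... | zero        = λ ()
      ... | suc zero    = λ ()
      ... | suc (suc _) = λ ()

    b≢0 : ∀ j → j < D → p j 1 (suc j) ≢ 0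
    b≢0 j j<D with vertex-at (suc j) j<D
    ... | z , d[u,z]≡j+1 with predecessor d[u,z]≡j+1
    ...   | x , d[u,x]≡j , x~z =
      count-some _ (from T-∧ (ℕ.≡⇒≡ᵇ _ _ (adj⇒dist≡1 x~z) , ℕ.≡⇒≡ᵇ _ _ d[u,z]≡j+1))
        ∘ trans (regular j 1 (suc j) (ℕ.<⇒≤ j<D) 1≤D j<D x u (trans (dist-sym x u) d[u,x]≡j))

    c≢0 : ∀ j → suc j < D → p (suc j) 1 j ≢ 0
    c≢0 j j+1<D with vertex-at (suc j) (ℕ.<⇒≤ j+1<D)
    ... | z , d[u,z]≡j+1 with predecessor d[u,z]≡j+1
    ...   | x , d[u,x]≡j , x~z =
      count-some _ (from T-∧ (ℕ.≡⇒≡ᵇ _ _ (adj⇒dist≡1 (adjacent-sym x~z)) , ℕ.≡⇒≡ᵇ _ _ d[u,x]≡j))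
        ∘ trans (regular (suc j) 1 j (ℕ.<⇒≤ j+1<D) 1≤D (ℕ.≤-trans (ℕ.n≤1+n j) (ℕ.<⇒≤ j+1<D)) z u
                         (trans (dist-sym z u) d[u,z]≡j+1))

    k≡a+b+c : ∀ j → suc j < D → p 0 1 1 ≡ p (suc j) 1 (suc j) ℕ.+ p (suc j) 1 (suc (suc j)) ℕ.+ p (suc j) 1 j
    k≡a+b+c j j+1<D with vertex-at (suc j) (ℕ.<⇒≤ j+1<D)
    ... | x , d[u,x]≡j+1 = begin
      p 0 1 1
        ≡⟨ sym (regular 0 1 1 z≤n 1≤D 1≤D x x (dist-refl x)) ⟩
      countIn (λ w → (dist x w ≡ᵇ 1) ∧ (dist x w ≡ᵇ 1)) vertices
        ≡⟨ countIn-sum₃ _ _ _ _ neighbours-by-level vertices ⟩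
      countIn (at (suc j)) vertices ℕ.+ countIn (at (suc (suc j))) vertices ℕ.+ countIn (at j) vertices
        ≡⟨ cong₂ ℕ._+_ (cong₂ ℕ._+_ (count≡p (suc j) j+1≤D) (count≡p (suc (suc j)) j+1<D))
                       (count≡p j (ℕ.≤-trans (ℕ.n≤1+n j) j+1≤D)) ⟩
      p (suc j) 1 (suc j) ℕ.+ p (suc j) 1 (suc (suc j)) ℕ.+ p (suc j) 1 j ∎
      where
      open ≡-Reasoning
      j+1≤D = ℕ.<⇒≤ j+1<D
      d[x,u]≡j+1 = trans (dist-sym x u) d[u,x]≡j+1

      at : ℕ → Vertex → Bool
      at i w = (dist x w ≡ᵇ 1) ∧ (dist u w ≡ᵇ i)

      count≡p : ∀ i → i ≤ D → countIn (at i) vertices ≡ p (suc j) 1 i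
      count≡p i i≤D = regular (suc j) 1 i j+1≤D 1≤D i≤D x u d[x,u]≡j+1

      neighbours-by-level : ∀ w → indicator ((dist x w ≡ᵇ 1) ∧ (dist x w ≡ᵇ 1)) ≡
                                  indicator (at (suc j) w) ℕ.+ indicator (at (suc (suc j)) w) ℕ.+ indicator (at j w)
      neighbours-by-level w with dist x w ≡ᵇ 1 in d≡ᵇ1
      ... | false = refl
      ... | true  = sym (indicator-window j (dist u w) j≤d[u,w] d[u,w]≤j+2)
        where
        x~w : T (adj x w)
        x~w = dist≡1⇒adj (ℕ.≡ᵇ⇒≡ _ _ (from T-≡ d≡ᵇ1))
        d[u,w]≤j+2 : dist u w ≤ suc (suc j)
        d[u,w]≤j+2 = subst (λ t → dist u w ≤ suc t) d[u,x]≡j+1 (dist-adj-≤ x~w)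
        j≤d[u,w] : j ≤ dist u w
        j≤d[u,w] = ℕ.≤-pred (subst (_≤ suc (dist u w)) d[u,x]≡j+1 (dist-adj-≤ (adjacent-sym x~w)))

module PseudoCosines (R : RealField) (D : ℕ) (p : ℕ → ℕ → ℕ → ℕ) where
  open RealField R
  open RealFieldFacts R
  open DRG R D p
  open ≡-Reasoning

  K : Carrier
  K = fromℕ k

  A B C : ℕ → Carrier
  A i = fromℕ (a i)
  B i = fromℕ (b i)
  C i = fromℕ (c i)

  recurrence : ∀ {θ σ} → IsPseudoCosine θ σ → ∀ i → i < D →
               lowerTerm σ i + A i * σ i + B i * σ (suc i) + - (θ * σ i) ≡ 0#
  recurrence (_ , σ-rec) i i<D = x≡y⇒x-y≡0 (σ-rec i i<D)

  B*σ[i+1]≡ : ∀ {θ σ} → IsPseudoCosine θ σ → ∀ i → i < D →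
            B i * σ (suc i) ≡ θ * σ i + - (lowerTerm σ i + A i * σ i)
  B*σ[i+1]≡ {θ} {σ} σ-cos i i<D = x-y≡0⇒x≡y (begin
    B i * σ (suc i) + - (θ * σ i + - (lowerTerm σ i + A i * σ i))
      ≡⟨ solve 5 (λ l a b θ s → b :- (θ :- (l :+ a)) := l :+ a :+ b :- θ) refl
                 (lowerTerm σ i) (A i * σ i) (B i * σ (suc i)) (θ * σ i) (σ (suc i)) ⟩
    lowerTerm σ i + A i * σ i + B i * σ (suc i) + - (θ * σ i)
      ≡⟨ recurrence σ-cos i i<D ⟩
    0# ∎)

  IsPseudoCosine-resp : ∀ {θ σ σ'} → (∀ i → i ≤ D → σ i ≡ σ' i) →
                        IsPseudoCosine θ σ → IsPseudoCosine θ σ'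
  IsPseudoCosine-resp {θ} {σ} {σ'} σ≗σ' (σ₀≡1 , σ-rec) = trans (sym (σ≗σ' 0 z≤n)) σ₀≡1 , σ'-rec
    where
    lowerTerm≡ : ∀ i → i ≤ D → lowerTerm σ i ≡ lowerTerm σ' i
    lowerTerm≡ zero    _   = refl
    lowerTerm≡ (suc i) i<D = cong (C (suc i) *_) (σ≗σ' i (ℕ.<⇒≤ i<D))
    σ'-rec : ∀ i → i < D → lowerTerm σ' i + A i * σ' i + B i * σ' (suc i) ≡ θ * σ' i
    σ'-rec i i<D = begin
      lowerTerm σ' i + A i * σ' i + B i * σ' (suc i)
        ≡⟨ cong₂ (λ l s → l + A i * s + B i * σ' (suc i))
                 (sym (lowerTerm≡ i (ℕ.<⇒≤ i<D))) (sym (σ≗σ' i (ℕ.<⇒≤ i<D))) ⟩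
      lowerTerm σ i + A i * σ i + B i * σ' (suc i)
        ≡⟨ cong (λ s → lowerTerm σ i + A i * σ i + B i * s) (sym (σ≗σ' (suc i) i<D)) ⟩
      lowerTerm σ i + A i * σ i + B i * σ (suc i)
        ≡⟨ σ-rec i i<D ⟩
      θ * σ i
        ≡⟨ cong (θ *_) (σ≗σ' i (ℕ.<⇒≤ i<D)) ⟩
      θ * σ' i ∎

  module _ (a₀≡0 : a 0 ≡ 0) (b≢0 : ∀ i → i < D → b i ≢ 0) (c≢0 : ∀ i → suc i < D → c (suc i) ≢ 0)
           (k≡a+b+c : ∀ i → suc i < D → k ≡ a (suc i) ℕ.+ b (suc i) ℕ.+ c (suc i)) where

    K≢0 : 0 < D → K ≢ 0#
    K≢0 0<D = fromℕ-≢0 (b≢0 0 0<D)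

    K-A-B-C≡0 : ∀ i → suc i < D → K + - (A (suc i) + B (suc i) + C (suc i)) ≡ 0#
    K-A-B-C≡0 i i+1<D = x≡y⇒x-y≡0 (begin
      fromℕ k                                                   ≡⟨ cong fromℕ (k≡a+b+c i i+1<D) ⟩
      fromℕ (a (suc i) ℕ.+ b (suc i) ℕ.+ c (suc i))             ≡⟨ fromℕ-+ (a (suc i) ℕ.+ b (suc i)) _ ⟩
      fromℕ (a (suc i) ℕ.+ b (suc i)) + C (suc i)               ≡⟨ cong (_+ C (suc i)) (fromℕ-+ (a (suc i)) _) ⟩
      A (suc i) + B (suc i) + C (suc i)                         ∎)

    θ≡Kσ₁ : ∀ {θ σ} → IsPseudoCosine θ σ → 0 < D → θ ≡ K * σ 1
    θ≡Kσ₁ {θ} {σ} σ-cos@(σ₀≡1 , _) 0<D = x-y≡0⇒x≡y (trans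
      (solve 5 (λ θ K a₀ σ₀ σ₁ → θ :- K :* σ₁ :=
         (:- :1) :* (:0 :+ a₀ :* σ₀ :+ K :* σ₁ :- θ :* σ₀) :+ σ₀ :* a₀ :+ (:- θ) :* (σ₀ :- :1))
         refl θ K (A 0) (σ 0) (σ 1))
      (multiple (recurrence σ-cos 0 0<D) ⊞ multiple (cong fromℕ a₀≡0) ⊞ multiple (x≡y⇒x-y≡0 σ₀≡1)))

    pseudoCosine-unique : ∀ {θ σ σ'} → IsPseudoCosine θ σ → IsPseudoCosine θ σ' → ∀ i → i ≤ D → σ i ≡ σ' i
    pseudoCosine-unique {θ} {σ} {σ'} σ-cos σ'-cos = agree
      where
      σ₀≡σ'₀ : σ 0 ≡ σ' 0
      σ₀≡σ'₀ = trans (proj₁ σ-cos) (sym (proj₁ σ'-cos))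

      next-agree : ∀ i → i < D → lowerTerm σ i ≡ lowerTerm σ' i → σ i ≡ σ' i → σ (suc i) ≡ σ' (suc i)
      next-agree i i<D l≡l' s≡s' = *-cancelˡ (fromℕ-≢0 (b≢0 i i<D)) (begin
        B i * σ (suc i)                              ≡⟨ B*σ[i+1]≡ σ-cos i i<D ⟩
        θ * σ i + - (lowerTerm σ i + A i * σ i)      ≡⟨ cong₂ (λ l s → θ * s + - (l + A i * s)) l≡l' s≡s' ⟩
        θ * σ' i + - (lowerTerm σ' i + A i * σ' i)   ≡⟨ sym (B*σ[i+1]≡ σ'-cos i i<D) ⟩
        B i * σ' (suc i)                             ∎)

      agree₂ : ∀ i → i < D → σ i ≡ σ' i × σ (suc i) ≡ σ' (suc i)
      agree₂ zero    0<D   = σ₀≡σ'₀ , next-agree 0 0<D refl σ₀≡σ'₀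
      agree₂ (suc i) i+1<D with agree₂ i (ℕ.<⇒≤ i+1<D)
      ... | σi≡ , σi+1≡ = σi+1≡ , next-agree (suc i) i+1<D (cong (C (suc i) *_) σi≡) σi+1≡

      agree : ∀ i → i ≤ D → σ i ≡ σ' i
      agree zero    _     = σ₀≡σ'₀
      agree (suc i) i<D   = proj₂ (agree₂ i i<D)

    no-consecutive-zeros : ∀ {θ σ} → IsPseudoCosine θ σ → ∀ i → i < D → σ i ≡ 0# → σ (suc i) ≡ 0# → ⊥
    no-consecutive-zeros (σ₀≡1 , _) zero 0<D σ₀≡0 _ = 0≢1 (trans (sym σ₀≡0) σ₀≡1)
    no-consecutive-zeros {θ} {σ} σ-cos (suc i) i+1<D σi+1≡0 σi+2≡0 =
      no-consecutive-zeros σ-cos i (ℕ.<⇒≤ i+1<D) σi≡0 σi+1≡0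
      where
      σi≡0 : σ i ≡ 0#
      σi≡0 = x*y≡0⇒y≡0 (fromℕ-≢0 (c≢0 i i+1<D)) (trans
        (solve 7 (λ c a b θ u v w → c :* u := :1 :* (c :* u :+ a :* v :+ b :* w :- θ :* v) :+ (θ :- a) :* v :+ (:- b) :* w)
           refl (C (suc i)) (A (suc i)) (B (suc i)) θ (σ i) (σ (suc i)) (σ (suc (suc i))))
        (multiple (recurrence σ-cos (suc i) i+1<D) ⊞ multiple σi+1≡0 ⊞ multiple σi+2≡0))

    module Cosine {θ : Carrier} {σ : ℕ → Carrier} (σ-cos : IsPseudoCosine θ σ) (3≤D : 3 ≤ D) where

      Partner : Carrier → Set
      Partner θ' = Σ (ℕ → Carrier) λ ρ → IsPseudoCosine θ' ρ × TightSeq σ ρ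

      TightPair⇒Partner : ∀ {θ'} → TightPair θ θ' → Partner θ'
      TightPair⇒Partner (σ' , ρ , σ'-cos , ρ-cos , η , σ'ρ-cos) =
        ρ , ρ-cos , η , IsPseudoCosine-resp (λ i i≤D → cong (_* ρ i) (pseudoCosine-unique σ'-cos σ-cos i i≤D)) σ'ρ-cos

      0<D : 0 < D
      0<D = ℕ.≤-trans (s≤s z≤n) 3≤D

      1<D : 1 < D
      1<D = ℕ.≤-trans (s≤s (s≤s z≤n)) 3≤D

      s : Carrier
      s = σ 1

      θ≡Ks : θ ≡ K * s
      θ≡Ks = θ≡Kσ₁ σ-cos 0<D

      -- X = b₁σ₂ by the recurrence at 1, so α = k b₁ (σ₂ − σ₁²) and β = a₁ b₁ (σ₁ − σ₂).
      X α β : Carrier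
      X = K * s * s + - (A 1 * s) + - C 1
      α = K * (X + - (B 1 * s * s))
      β = A 1 * (B 1 * s + - X)

      partner-relation : ∀ {θ'} → Partner θ' → θ' ≢ K → α * (θ' + K) + K * β ≡ 0#
      partner-relation {θ'} (ρ , ρ-cos , η , τ-cos) θ'≢K = trans
        (solve 5 (λ α β K θ' r → α :* (θ' :+ K) :+ K :* β := K :* (α :* (r :+ :1) :+ β) :+ α :* (θ' :- K :* r))
           refl α β K θ' r)
        (multiple α[r+1]+β≡0 ⊞ multiple (x≡y⇒x-y≡0 θ'≡Kr))
        where
        r = ρ 1
        θ'≡Kr = θ≡Kσ₁ ρ-cos 0<D
        r≢1 : r ≢ 1#
        r≢1 r≡1 = θ'≢K (trans θ'≡Kr (trans (cong (K *_) r≡1) (*-identityʳ K)))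
        rec₁ : ∀ {ζ μ} → IsPseudoCosine ζ μ → C 1 * 1# + A 1 * μ 1 + B 1 * μ 2 + - (K * μ 1 * μ 1) ≡ 0#
        rec₁ {ζ} {μ} μ-cos@(μ₀≡1 , _) =
          trans (cong₂ (λ u t → C 1 * u + A 1 * μ 1 + B 1 * μ 2 + - (t * μ 1)) (sym μ₀≡1) (sym (θ≡Kσ₁ μ-cos 0<D)))
                (recurrence μ-cos 1 1<D)
        [r-1][α[r+1]+β]≡0 : (r + - 1#) * (α * (r + 1#) + β) ≡ 0#
        [r-1][α[r+1]+β]≡0 = trans
          (solve 8 (λ K A B C s r σ₂ ρ₂ →
             let X = K :* s :* s :- A :* s :- C
                 Y = K :* r :* r :- A :* r :- C
                 α = K :* (X :- B :* s :* s)
                 β = A :* (B :* s :- X)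
             in (r :- :1) :* (α :* (r :+ :1) :+ β) :=
                (:- Y) :* (C :* :1 :+ A :* s :+ B :* σ₂ :- K :* s :* s)
                :+ (:- (B :* σ₂)) :* (C :* :1 :+ A :* r :+ B :* ρ₂ :- K :* r :* r)
                :+ B :* (C :* :1 :+ A :* (s :* r) :+ B :* (σ₂ :* ρ₂) :- K :* (s :* r) :* (s :* r))
                :+ (:- X) :* (K :- (A :+ B :+ C)))
             refl K (A 1) (B 1) (C 1) s r (σ 2) (ρ 2))
          (multiple (rec₁ σ-cos) ⊞ multiple (rec₁ ρ-cos) ⊞ multiple (rec₁ τ-cos) ⊞ multiple (K-A-B-C≡0 0 1<D))
        α[r+1]+β≡0 : α * (r + 1#) + β ≡ 0#
        α[r+1]+β≡0 = x*y≡0⇒y≡0 (λ r-1≡0 → r≢1 (x-y≡0⇒x≡y r-1≡0)) [r-1][α[r+1]+β]≡0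

      α≡0∧β≡0 : ∀ {θ' θ''} → θ' ≢ K → θ'' ≢ K → θ' ≢ θ'' → Partner θ' → Partner θ'' →
                α ≡ 0# × β ≡ 0#
      α≡0∧β≡0 {θ'} {θ''} θ'≢K θ''≢K θ'≢θ'' P' P'' = α≡0 , β≡0
        where
        rel' : α * (θ' + K) + K * β ≡ 0#
        rel' = partner-relation P' θ'≢K
        rel'' : α * (θ'' + K) + K * β ≡ 0#
        rel'' = partner-relation P'' θ''≢K
        α≡0 : α ≡ 0#
        α≡0 = x*y≡0⇒y≡0 (λ θ'-θ''≡0 → θ'≢θ'' (x-y≡0⇒x≡y θ'-θ''≡0)) (trans
          (solve 5 (λ α β K t₁ t₂ → (t₁ :- t₂) :* α :=
             :1 :* (α :* (t₁ :+ K) :+ K :* β) :+ (:- :1) :* (α :* (t₂ :+ K) :+ K :* β)) refl α β K θ' θ'')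
          (multiple rel' ⊞ multiple rel''))
        β≡0 : β ≡ 0#
        β≡0 = x*y≡0⇒y≡0 (K≢0 0<D) (trans
          (solve 4 (λ α β K t → K :* β := :1 :* (α :* (t :+ K) :+ K :* β) :+ (:- (t :+ K)) :* α) refl α β K θ')
          (multiple rel' ⊞ multiple α≡0))

      s²-1≡0 : α ≡ 0# → β ≡ 0# → s * s + - 1# ≡ 0#
      s²-1≡0 α≡0 β≡0 = x*y≡0⇒y≡0 (fromℕ-≢0 (b≢0 1 1<D)) (trans
        (solve 3 (λ X B s → B :* (s :* s :- :1) := (:- :1) :* (X :- B :* s :* s) :+ (:- :1) :* (B :- X))
           refl X (B 1) s)
        (multiple (x*y≡0⇒y≡0 (K≢0 0<D) α≡0) ⊞ multiple (x*y≡0⇒y≡0 (fromℕ-≢0 (c≢0 0 1<D)) c₁[b₁-X]≡0)))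
        where
        c₁[b₁-X]≡0 : C 1 * (B 1 + - X) ≡ 0#
        c₁[b₁-X]≡0 = trans
          (solve 5 (λ K A B C s →
             let X = K :* s :* s :- A :* s :- C
                 α = K :* (X :- B :* s :* s)
                 β = A :* (B :* s :- X)
             in C :* (B :- X) := (:- :1) :* α :+ (:- :1) :* β :+ X :* (K :- (A :+ B :+ C))) refl K (A 1) (B 1) (C 1) s)
          (multiple α≡0 ⊞ multiple β≡0 ⊞ multiple (K-A-B-C≡0 0 1<D))

      s²-1≡0⇒s+1≡0 : θ ≢ K → s * s + - 1# ≡ 0# → s + 1# ≡ 0#
      s²-1≡0⇒s+1≡0 θ≢K s²-1≡0 = x*y≡0⇒y≡0 s-1≢0
        (trans (solve 1 (λ s → (s :- :1) :* (s :+ :1) := :1 :* (s :* s :- :1)) refl s) (multiple s²-1≡0))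
        where
        s-1≢0 : s + - 1# ≢ 0#
        s-1≢0 s-1≡0 = θ≢K (trans θ≡Ks (trans (cong (K *_) (x-y≡0⇒x≡y s-1≡0)) (*-identityʳ K)))

      module σ₁≡-1 (s+1≡0 : s + 1# ≡ 0#) where

        θ+K≡0 : θ + K ≡ 0#
        θ+K≡0 = trans (solve 3 (λ θ K s → θ :+ K := :1 :* (θ :- K :* s) :+ K :* (s :+ :1)) refl θ K s)
                      (multiple (x≡y⇒x-y≡0 θ≡Ks) ⊞ multiple s+1≡0)

        η+θ'≡0 : ∀ {θ' ρ η} → IsPseudoCosine θ' ρ → IsPseudoCosine η (λ i → σ i * ρ i) → η + θ' ≡ 0#
        η+θ'≡0 {θ'} {ρ} {η} ρ-cos τ-cos = trans
          (solve 5 (λ η θ' K s r → η :+ θ' := :1 :* (η :- K :* (s :* r)) :+ :1 :* (θ' :- K :* r) :+ (K :* r) :* (s :+ :1))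
             refl η θ' K s (ρ 1))
          (multiple (x≡y⇒x-y≡0 (θ≡Kσ₁ τ-cos 0<D)) ⊞ multiple (x≡y⇒x-y≡0 (θ≡Kσ₁ ρ-cos 0<D))
           ⊞ multiple s+1≡0)

        Alternating : ℕ → Set
        Alternating j = (σ j + σ (suc j) ≡ 0#) × (σ (suc j) ≢ 0#)

        alternating-0 : Alternating 0
        alternating-0 = trans (solve 2 (λ u s → u :+ s := :1 :* (u :- :1) :+ :1 :* (s :+ :1)) refl (σ 0) s)
                              (multiple (x≡y⇒x-y≡0 (proj₁ σ-cos)) ⊞ multiple s+1≡0)
                      , λ s≡0 → 0≢1 (sym (trans (sym (+-identityˡ 1#)) (trans (cong (_+ 1#) (sym s≡0)) s+1≡0)))

        module Step (j : ℕ) (j+2<D : suc (suc j) < D) (alt : Alternating j) where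
          i : ℕ
          i = suc j

          i<D : i < D
          i<D = ℕ.<⇒≤ j+2<D

          e f g : Carrier
          e = σ i
          f = σ (suc i)
          g = σ (suc (suc i))

          σⱼ+e≡0 : σ j + e ≡ 0#
          σⱼ+e≡0 = proj₁ alt

          e≢0 : e ≢ 0#
          e≢0 = proj₂ alt

          K-A-B-Cᵢ≡0 : K + - (A i + B i + C i) ≡ 0#
          K-A-B-Cᵢ≡0 = K-A-B-C≡0 j i<D

          K-A-B-Cᵢ₊₁≡0 : K + - (A (suc i) + B (suc i) + C (suc i)) ≡ 0#
          K-A-B-Cᵢ₊₁≡0 = K-A-B-C≡0 i j+2<D

          -- ρ_{i+2} eliminated between the recurrences of ρ and σρ at i + 1, using ρᵢ = ρᵢ₊₁
          partnerForm : Carrier → Carrier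
          partnerForm t = B (suc i) * (C (suc i) * e + A (suc i) * f)
                          + - ((K * f + C (suc i) * e + A (suc i) * f) * (t + - C (suc i) + - A (suc i)))
                          + B (suc i) * t * f

          partner-ρᵢ≡ρᵢ₊₁ : ∀ {θ' ρ η} → a i ≢ 0 →
                            IsPseudoCosine θ' ρ → IsPseudoCosine η (λ i → σ i * ρ i) → ρ i ≡ ρ (suc i)
          partner-ρᵢ≡ρᵢ₊₁ {θ'} {ρ} {η} aᵢ≢0 ρ-cos τ-cos =
            x-y≡0⇒x≡y $ x*y≡0⇒y≡0 (*-≢0 (*-≢0 2≢0 (fromℕ-≢0 aᵢ≢0)) e≢0) $ trans
            (solve 13 (λ c a b K θ θ' η σⱼ e f ρⱼ ρᵢ ρᵢ₊₁ →
               (:2 :* a) :* e :* (ρᵢ :- ρᵢ₊₁) :=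
                 :1 :* (c :* (σⱼ :* ρⱼ) :+ a :* (e :* ρᵢ) :+ b :* (f :* ρᵢ₊₁) :- η :* (e :* ρᵢ))
                 :+ e :* (c :* ρⱼ :+ a :* ρᵢ :+ b :* ρᵢ₊₁ :- θ' :* ρᵢ)
                 :+ (:- ρᵢ₊₁) :* (c :* σⱼ :+ a :* e :+ b :* f :- θ :* e)
                 :+ (:- (c :* ρⱼ)) :* (σⱼ :+ e) :+ (c :* ρᵢ₊₁) :* (σⱼ :+ e)
                 :+ (e :* ρᵢ) :* (η :+ θ') :+ (:- (e :* ρᵢ₊₁)) :* (θ :+ K) :+ (e :* ρᵢ₊₁) :* (K :- (a :+ b :+ c)))
               refl (C i) (A i) (B i) K θ θ' η (σ j) e f (ρ j) (ρ i) (ρ (suc i)))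
            (multiple (recurrence τ-cos i i<D) ⊞ multiple (recurrence ρ-cos i i<D) ⊞ multiple (recurrence σ-cos i i<D)
             ⊞ multiple σⱼ+e≡0 ⊞ multiple σⱼ+e≡0 ⊞ multiple (η+θ'≡0 ρ-cos τ-cos) ⊞ multiple θ+K≡0
             ⊞ multiple K-A-B-Cᵢ≡0)
            where
            2≢0 : fromℕ₁ 2 ≢ 0#
            2≢0 2≡0 = fromℕ-≢0 {2} (λ ()) (trans (sym (fromℕ₁≗fromℕ 2)) 2≡0)

          partnerForm-root : ∀ {θ'} → Partner θ' → a i ≢ 0 → partnerForm θ' ≡ 0#
          partnerForm-root {θ'} (ρ , ρ-cos , η , τ-cos) aᵢ≢0 = x*y≡0⇒y≡0 ρᵢ₊₁≢0 ρᵢ₊₁*form≡0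
            where
            ρᵢ≡ρᵢ₊₁ : ρ i ≡ ρ (suc i)
            ρᵢ≡ρᵢ₊₁ = partner-ρᵢ≡ρᵢ₊₁ aᵢ≢0 ρ-cos τ-cos
            ρᵢ₊₁≢0 : ρ (suc i) ≢ 0#
            ρᵢ₊₁≢0 ρᵢ₊₁≡0 = no-consecutive-zeros ρ-cos i i<D (trans ρᵢ≡ρᵢ₊₁ ρᵢ₊₁≡0) ρᵢ₊₁≡0
            ρᵢ₊₁*form≡0 : ρ (suc i) * partnerForm θ' ≡ 0#
            ρᵢ₊₁*form≡0 = trans
              (solve 13 (λ c' a' b' K θ θ' η e f g ρᵢ q ρᵢ₊₂ →
                 let G = (:- (c' :* e)) :- a' :* f :+ θ :* f
                     H = (:- (c' :* ρᵢ)) :- a' :* q :+ θ' :* q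
                 in q :* (b' :* (c' :* e :+ a' :* f) :- (K :* f :+ c' :* e :+ a' :* f) :* (θ' :- c' :- a') :+ b' :* θ' :* f) :=
                   b' :* (c' :* (e :* ρᵢ) :+ a' :* (f :* q) :+ b' :* (g :* ρᵢ₊₂) :- η :* (f :* q))
                   :+ (:- (b' :* ρᵢ₊₂)) :* (c' :* e :+ a' :* f :+ b' :* g :- θ :* f)
                   :+ (:- G) :* (c' :* ρᵢ :+ a' :* q :+ b' :* ρᵢ₊₂ :- θ' :* q)
                   :+ (:- ((K :* f :+ c' :* e :+ a' :* f) :* c')) :* (ρᵢ :- q)
                   :+ (:- (f :* H)) :* (θ :+ K)
                   :+ (:- (b' :* c' :* e)) :* (ρᵢ :- q)
                   :+ (b' :* f :* q) :* (η :+ θ'))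
                 refl (C (suc i)) (A (suc i)) (B (suc i)) K θ θ' η e f g (ρ i) (ρ (suc i)) (ρ (suc (suc i))))
              (multiple (recurrence τ-cos (suc i) j+2<D) ⊞ multiple (recurrence σ-cos (suc i) j+2<D)
               ⊞ multiple (recurrence ρ-cos (suc i) j+2<D) ⊞ multiple (x≡y⇒x-y≡0 ρᵢ≡ρᵢ₊₁) ⊞ multiple θ+K≡0
               ⊞ multiple (x≡y⇒x-y≡0 ρᵢ≡ρᵢ₊₁) ⊞ multiple (η+θ'≡0 ρ-cos τ-cos))

          N : Carrier
          N = fromℕ₁ 4 * A i * A (suc i) + fromℕ₁ 2 * A i * C (suc i) + fromℕ₁ 2 * A (suc i) * B i

          N≢0 : a i ≢ 0 → N ≢ 0#
          N≢0 aᵢ≢0 N≡0 = fromℕ-≢0 n≢0 (trans fromℕ-n≡N N≡0)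
            where
            n : ℕ
            n = 4 ℕ.* a i ℕ.* a (suc i) ℕ.+ 2 ℕ.* a i ℕ.* c (suc i) ℕ.+ 2 ℕ.* a (suc i) ℕ.* b i
            fromℕ-*₃ : ∀ m x y → fromℕ (m ℕ.* x ℕ.* y) ≡ fromℕ₁ m * fromℕ x * fromℕ y
            fromℕ-*₃ m x y = trans (fromℕ-* (m ℕ.* x) y)
              (cong (_* fromℕ y) (trans (fromℕ-* m x) (cong (_* fromℕ x) (sym (fromℕ₁≗fromℕ m)))))
            fromℕ-n≡N : fromℕ n ≡ N
            fromℕ-n≡N = begin
              fromℕ n
                ≡⟨ fromℕ-+ (4 ℕ.* a i ℕ.* a (suc i) ℕ.+ 2 ℕ.* a i ℕ.* c (suc i)) _ ⟩
              fromℕ (4 ℕ.* a i ℕ.* a (suc i) ℕ.+ 2 ℕ.* a i ℕ.* c (suc i)) + fromℕ (2 ℕ.* a (suc i) ℕ.* b i)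
                ≡⟨ cong₂ _+_ (fromℕ-+ (4 ℕ.* a i ℕ.* a (suc i)) _) (fromℕ-*₃ 2 (a (suc i)) (b i)) ⟩
              fromℕ (4 ℕ.* a i ℕ.* a (suc i)) + fromℕ (2 ℕ.* a i ℕ.* c (suc i)) + fromℕ₁ 2 * A (suc i) * B i
                ≡⟨ cong (_+ fromℕ₁ 2 * A (suc i) * B i)
                        (cong₂ _+_ (fromℕ-*₃ 4 (a i) (a (suc i))) (fromℕ-*₃ 2 (a i) (c (suc i)))) ⟩
              N ∎
            n≢0 : n ≢ 0
            n≢0 n≡0 with ℕ.m*n≡0⇒m≡0∨n≡0 (2 ℕ.* a i)
                           (ℕ.m+n≡0⇒n≡0 (4 ℕ.* a i ℕ.* a (suc i)) (ℕ.m+n≡0⇒m≡0 _ n≡0))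
            ... | inj₂ cᵢ₊₁≡0 = c≢0 i j+2<D cᵢ₊₁≡0
            ... | inj₁ 2aᵢ≡0 with ℕ.m*n≡0⇒m≡0∨n≡0 2 2aᵢ≡0
            ...   | inj₂ aᵢ≡0 = aᵢ≢0 aᵢ≡0

          partnerForm-roots-equal : ∀ {θ' θ''} → a i ≢ 0 →
                                    partnerForm θ' ≡ 0# → partnerForm θ'' ≡ 0# → θ' ≡ θ''
          partnerForm-roots-equal {θ'} {θ''} aᵢ≢0 form'≡0 form''≡0 =
            x-y≡0⇒x≡y $ x*y≡0⇒y≡0 (*-≢0 e≢0 (N≢0 aᵢ≢0)) $ trans
            (solve 13 (λ a b c a' b' c' K θ θ' θ'' e f σⱼ →
               let N = con (ℤ.+ 4) :* a :* a' :+ :2 :* a :* c' :+ :2 :* a' :* b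
                   form = λ t → b' :* (c' :* e :+ a' :* f) :- (K :* f :+ c' :* e :+ a' :* f) :* (t :- c' :- a') :+ b' :* t :* f
                   w = (θ' :- θ'') :* (:2 :* a' :+ c')
               in (e :* N) :* (θ' :- θ'') :=
                 b :* form θ' :+ (:- b) :* form θ''
                 :+ w :* (c :* σⱼ :+ a :* e :+ b :* f :- θ :* e)
                 :+ (:- (w :* c)) :* (σⱼ :+ e)
                 :+ (w :* e) :* (θ :+ K)
                 :+ (:- (w :* e)) :* (K :- (a :+ b :+ c))
                 :+ ((θ' :- θ'') :* b :* f) :* (K :- (a' :+ b' :+ c')))
               refl (A i) (B i) (C i) (A (suc i)) (B (suc i)) (C (suc i)) K θ θ' θ'' e f (σ j))
            (multiple form'≡0 ⊞ multiple form''≡0 ⊞ multiple (recurrence σ-cos i i<D) ⊞ multiple σⱼ+e≡0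
             ⊞ multiple θ+K≡0 ⊞ multiple K-A-B-Cᵢ≡0 ⊞ multiple K-A-B-Cᵢ₊₁≡0)

          alternating-suc : a i ≡ 0 → Alternating i
          alternating-suc aᵢ≡0 = e+f≡0 , f≢0
            where
            e+f≡0 : e + f ≡ 0#
            e+f≡0 = x*y≡0⇒y≡0 (fromℕ-≢0 (b≢0 i i<D)) (trans
              (solve 8 (λ c a b K θ σⱼ e f → b :* (e :+ f) :=
                 :1 :* (c :* σⱼ :+ a :* e :+ b :* f :- θ :* e) :+ (:- c) :* (σⱼ :+ e) :+ e :* (θ :+ K)
                 :+ (:- e) :* (K :- (a :+ b :+ c)) :+ (:- (:2 :* e)) :* a)
                 refl (C i) (A i) (B i) K θ (σ j) e f)
              (multiple (recurrence σ-cos i i<D) ⊞ multiple σⱼ+e≡0 ⊞ multiple θ+K≡0 ⊞ multiple K-A-B-Cᵢ≡0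
               ⊞ multiple (cong fromℕ aᵢ≡0)))
            f≢0 : f ≢ 0#
            f≢0 f≡0 = e≢0 (trans (sym (trans (cong (e +_) f≡0) (+-identityʳ e))) e+f≡0)

        a≡0 : ∀ {θ' θ''} → θ' ≢ θ'' → Partner θ' → Partner θ'' → ∀ i → i ≤ D ∸ 2 → a i ≡ 0
        a≡0 θ'≢θ'' P' P'' = a≡0-below
          where
          a-next≡0 : ∀ j → suc (suc j) < D → Alternating j → a (suc j) ≡ 0
          a-next≡0 j j+2<D alt with a (suc j) ℕ.≟ 0
          ... | yes aⱼ₊₁≡0 = aⱼ₊₁≡0
          ... | no  aⱼ₊₁≢0 = ⊥-elim (θ'≢θ'' (partnerForm-roots-equal aⱼ₊₁≢0
                                               (partnerForm-root P' aⱼ₊₁≢0) (partnerForm-root P'' aⱼ₊₁≢0)))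
            where open Step j j+2<D alt

          alternating : ∀ j → suc (suc j) < D → Alternating j
          alternating zero    _     = alternating-0
          alternating (suc j) j+3<D = Step.alternating-suc j j+2<D alt (a-next≡0 j j+2<D alt)
            where
            j+2<D = ℕ.<⇒≤ j+3<D
            alt   = alternating j j+2<D

          a≡0-below : ∀ i → i ≤ D ∸ 2 → a i ≡ 0
          a≡0-below zero    _         = a₀≡0
          a≡0-below (suc j) j+1≤D∸2 = a-next≡0 j j+2<D (alternating j j+2<D)
            where
            j+2<D : suc (suc j) < D
            j+2<D = subst (_≤ D) (ℕ.+-comm (suc j) 2) (ℕ.m≤o∸n⇒m+n≤o (suc j) 1<D j+1≤D∸2)

    two-tight-partners⇒a≡0∧θ≡-k : 3 ≤ D → ∀ {θ θ' θ''} → θ ≢ K → θ' ≢ K → θ'' ≢ K → θ' ≢ θ'' →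
                                   TightPair θ θ' → TightPair θ θ'' → (∀ i → i ≤ D ∸ 2 → a i ≡ 0) × θ ≡ - K
    two-tight-partners⇒a≡0∧θ≡-k 3≤D {θ} {θ'} {θ''} θ≢K θ'≢K θ''≢K θ'≢θ'' tight'@(_ , _ , σ-cos , _) tight'' =
      a≡0 θ'≢θ'' P' P'' , θ≡-K
      where
      open Cosine σ-cos 3≤D
      P' : Partner θ'
      P' = TightPair⇒Partner tight'
      P'' : Partner θ''
      P'' = TightPair⇒Partner tight''
      s+1≡0 : s + 1# ≡ 0#
      s+1≡0 = s²-1≡0⇒s+1≡0 θ≢K (uncurry s²-1≡0 (α≡0∧β≡0 θ'≢K θ''≢K θ'≢θ'' P' P''))
      open σ₁≡-1 s+1≡0
      θ≡-K : θ ≡ - K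
      θ≡-K = x-y≡0⇒x≡y (trans (cong (θ +_) (-‿involutive K)) θ+K≡0)

lemma12p1 : (R : RealField) (Γ : Graph) (D : ℕ) (p : ℕ → ℕ → ℕ → ℕ) →
    Graph.Connected Γ → Graph.HasDiameter Γ D → Graph.IsDistanceRegular Γ D p →
    3 ≤ D →
    (θ θ' θ'' : RealField.Carrier R) →
    θ ≢ RealField.fromℕ R (DRG.k R D p) →
    θ' ≢ RealField.fromℕ R (DRG.k R D p) →
    θ'' ≢ RealField.fromℕ R (DRG.k R D p) →
    θ' ≢ θ'' →
    DRG.TightPair R D p θ θ' →
    DRG.TightPair R D p θ θ'' →
    ((i : ℕ) → i ≤ D ∸ 2 → DRG.a R D p i ≡ 0) ×
    (θ ≡ RealField.-_ R (RealField.fromℕ R (DRG.k R D p)))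
lemma12p1 R Γ D p connected diameter regular 3≤D θ θ' θ'' θ≢k θ'≢k θ''≢k θ'≢θ'' tight' tight'' =
  two-tight-partners⇒a≡0∧θ≡-k a₀≡0 b≢0 c≢0 k≡a+b+c 3≤D θ≢k θ'≢k θ''≢k θ'≢θ'' tight' tight''
  where
  open Distances Γ connected
  open IntersectionNumbers D p diameter regular (ℕ.≤-trans (s≤s z≤n) 3≤D)
  open PseudoCosines R D p using (two-tight-partners⇒a≡0∧θ≡-k)
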